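{- There is an absolute constant $C$ such that for every $n\ge 2$ and every simple temporal clique $\mathcal{G}$ on $n$ vertices, every forward fireworks cover of $\mathcal{G}$ has at most $\frac{3}{4}\binom{n}{2}+Cn$ edges.
   Context: A simple temporal clique is a pair $\mathcal{G}=(G,\lambda)$ where $G=(V,E)$ is the complete graph on a finite vertex set $V$ with $n=|V|\ge 2$, and $\lambda:E\to\mathbb{N}$ assigns each edge a single label such that any two distinct edges sharing an endpoint have distinct labels. For a vertex $v$, $e^-(v)$ denotes the edge incident to $v$ with the smallest label. Let $E^-$ be the set of arcs on $V$ containing, for each vertex $v$ with $e^-(v)=\{u,v\}$, the arc $(u,v)$, except that whenever $e^-(u)=e^-(v)$ only one of $(u,v),(v,u)$ is included (chosen arbitrarily). A sink of $E^-$ is a vertex of out-degree $0$ in $(V,E^-)$. $E^-_T$ is obtained from $E^-$ as follows: for every vertex $v$ of out-degree at least $2$ in $E^-$, let $(v,u_1),\dots,(v,u_\ell)$ be its out-arcs where $(v,u_\ell)$ has the largest label; for each $i<\ell$, if $u_i$ is a sink of $E^-$ replace $(v,u_i)$ by $(u_i,v)$, otherwise delete $(v,u_i)$. The emitters are the vertices of out-degree $0$ in $(V,E^-_T)$. A forward fireworks cover of $\mathcal{G}$ is the edge set $S^-_T=\{\{u,v\}: (u,v)\in E^-_T\}\cup\{\{u,v\}\in E: u\text{ is an emitter}\}$, for any of the arbitrary choices above. -}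

module Defs where

open import Data.Nat using (ℕ; suc; _<ᵇ_)
open import Data.Fin using (Fin; toℕ; _≟_)
open import Data.Bool using (Bool; true; false; not; _∧_; _∨_; if_then_else_)
open import Data.List using (List; []; _∷_; allFin; foldr; concatMap)
open import Data.Product using (_×_; _,_)
open import Relation.Nullary.Decidable using (⌊_⌋)
open import Relation.Binary.PropositionalEquality using (_≡_; _≢_)

-- A labelling of the complete graph on Fin n: lab u v is the label of edge {u,v}
-- (diagonal values are irrelevant).
Labelling : ℕ → Set
Labelling n = Fin n → Fin n → ℕ

IsSimpleTemporalClique : ∀ {n} → Labelling n → Set
IsSimpleTemporalClique {n} lab =
  (∀ (u v : Fin n) → lab u v ≡ lab v u) ×
  (∀ (u v w : Fin n) → u ≢ v → u ≢ w → v ≢ w → lab u v ≢ lab u w)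

all : ∀ {A : Set} → (A → Bool) → List A → Bool
all p = foldr (λ x b → p x ∧ b) true

count : ∀ {A : Set} → (A → Bool) → List A → ℕ
count p [] = 0
count p (x ∷ xs) = if p x then suc (count p xs) else count p xs

_==_ : ∀ {n} → Fin n → Fin n → Bool
u == v = ⌊ u ≟ v ⌋

-- isMin lab v u : e^-(v) = {u,v}, i.e. u is the neighbour of v with smallest label.
isMin : ∀ {n} → Labelling n → Fin n → Fin n → Bool
isMin {n} lab v u =
  not (u == v) ∧ all (λ w → (w == v) ∨ (w == u) ∨ (lab v u <ᵇ lab v w)) (allFin n)

-- A tie-breaking choice for mutual pairs (e^-(u) = e^-(v)): for u ≠ v exactly
-- one of c u v, c v u is true.
ValidChoice : ∀ {n} → (Fin n → Fin n → Bool) → Set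
ValidChoice {n} c = ∀ (u v : Fin n) → u ≢ v → c v u ≡ not (c u v)

-- The arc set E^- (arc (u,v) present iff e^-(v) = {u,v}, with the choice c
-- deciding the direction when e^-(u) = e^-(v)).
Eminus : ∀ {n} → Labelling n → (Fin n → Fin n → Bool) → Fin n → Fin n → Bool
Eminus lab c u v = isMin lab v u ∧ (not (isMin lab u v) ∨ c u v)

isSink : ∀ {n} → Labelling n → (Fin n → Fin n → Bool) → Fin n → Bool
isSink {n} lab c s = all (λ w → not (Eminus lab c s w)) (allFin n)

isMaxOut : ∀ {n} → Labelling n → (Fin n → Fin n → Bool) → Fin n → Fin n → Bool
isMaxOut {n} lab c v u =
  all (λ w → not (Eminus lab c v w) ∨ (w == u) ∨ (lab v w <ᵇ lab v u)) (allFin n)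

-- The arc set E^-_T: arcs of E^- that are the largest-label out-arc of their tail
-- (in particular all arcs whose tail has out-degree 1), together with reversed
-- arcs (u_i, v) for non-largest out-arcs (v,u_i) of E^- whose head u_i is a sink.
EminusT : ∀ {n} → Labelling n → (Fin n → Fin n → Bool) → Fin n → Fin n → Bool
EminusT lab c a b =
  (Eminus lab c a b ∧ isMaxOut lab c a b)
  ∨ (Eminus lab c b a ∧ not (isMaxOut lab c b a) ∧ isSink lab c a)

isEmitter : ∀ {n} → Labelling n → (Fin n → Fin n → Bool) → Fin n → Bool
isEmitter {n} lab c v = all (λ w → not (EminusT lab c v w)) (allFin n)

inCover : ∀ {n} → Labelling n → (Fin n → Fin n → Bool) → Fin n → Fin n → Bool
inCover lab c u v =
  not (u == v) ∧
  (EminusT lab c u v ∨ EminusT lab c v u ∨ isEmitter lab c u ∨ isEmitter lab c v)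

pairs : (n : ℕ) → List (Fin n × Fin n)
pairs n = concatMap (λ u → concatMap (λ v →
  if toℕ u <ᵇ toℕ v then (u , v) ∷ [] else []) (allFin n)) (allFin n)

coverSize : ∀ {n} → Labelling n → (Fin n → Fin n → Bool) → ℕ
coverSize {n} lab c = count (λ { (u , v) → inCover lab c u v }) (pairs n)

-- Every vertex has out-degree at most one in E⁻_T, so E⁻_T has at most n arcs, and every
-- other edge of the cover meets an emitter. An emitter s is a sink of E⁻ whose incoming
-- minimum-label arc (u, s) is the largest out-arc of u, so s ↦ u injects the e emitters
-- into the n − e non-emitters and e ≤ n/2. At most en − e²/2 ≤ 3n²/8 edges meet an
-- emitter, hence |S⁻_T| ≤ n + 3n²/8 ≤ (3/4)·C(n,2) + 2n.
module Submission where

open import Defs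
open import Data.Nat using (ℕ; _≤_; _+_; _*_)
open import Data.Nat.Combinatorics using (_C_)
open import Data.Fin using (Fin)
open import Data.Bool using (Bool)
open import Data.Product using (∃-syntax)

open import Data.Bool using (true; false; not; _∧_; _∨_; if_then_else_; T)
open import Data.Bool.Properties using (T-≡; T-∧; T-∨; ∨-assoc; ∨-comm)
open import Data.Empty using (⊥-elim)
open import Data.Fin using (zero; suc; toℕ; _≟_; punchIn)
open import Data.Fin.Properties using (suc-injective; punchInᵢ≢i)
open import Data.List using (List; []; _∷_; _++_; map; concat; tabulate; allFin)
open import Data.List.Relation.Unary.All using (All; []; _∷_)
open import Data.List.Relation.Unary.All.Properties using (tabulate⁺; tabulate⁻)
open import Data.Nat using (zero; suc; _<_; _<ᵇ_; z≤n; s≤s)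
open import Data.Nat.Combinatorics using (nC1≡n; nCk+nC[k+1]≡[n+1]C[k+1])
open import Data.Nat.Properties hiding (_≟_; suc-injective)
open import Data.Nat.Tactic.RingSolver using (solve-∀)
open import Data.Product using (_×_; _,_; proj₁; proj₂)
open import Data.Sum using (_⊎_; inj₁; inj₂)
open import Data.Unit using (tt)
open import Function using (id; _∘_; _∘₂_; _⇔_; mk⇔; Equivalence)
open import Relation.Binary.Bundles using (TotalPreorder)
import Relation.Binary.Construct.Flip.EqAndOrd as Flip
open import Relation.Binary.PropositionalEquality
open import Relation.Nullary using (¬_; yes; no; contradiction)
open import Relation.Nullary.Decidable using (T?; toWitnessFalse; fromWitnessFalse)
open import Algebra.Properties.Semiring.Sum +-*-semiring
  using (sum-syntax; sum-cong-≗; ∑-distrib-+; ∑-comm; *-distribˡ-sum; *-distribʳ-sum)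

open Equivalence using (to; from)

𝟙 : Bool → ℕ
𝟙 b = if b then 1 else 0

𝟙-true : ∀ {b} → T b → 𝟙 b ≡ 1
𝟙-true {true} _ = refl

T-not : ∀ {b} → T (not b) ⇔ (¬ T b)
T-not {true}  = mk⇔ (λ ()) (λ ¬t → ¬t tt)
T-not {false} = mk⇔ (λ _ ()) (λ _ → tt)

T-not-∨ : ∀ {a b} → T (not a ∨ b) ⇔ (T a → T b)
T-not-∨ {true}  = mk⇔ (λ t _ → t) (λ f → f tt)
T-not-∨ {false} = mk⇔ (λ _ ()) (λ _ → tt)

T-==-∨ : ∀ {n} {u v : Fin n} {b} → T ((u == v) ∨ b) ⇔ (u ≢ v → T b)
T-==-∨ {u = u} {v} with u ≟ v
... | yes u≡v = mk⇔ (λ _ u≢v → contradiction u≡v u≢v) (λ _ → tt)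
... | no  u≢v = mk⇔ (λ t _ → t) (λ f → f u≢v)

==-sym : ∀ {n} (u v : Fin n) → (u == v) ≡ (v == u)
==-sym u v with u ≟ v | v ≟ u
... | yes _   | yes _   = refl
... | no  _   | no  _   = refl
... | yes u≡v | no  v≢u = contradiction (sym u≡v) v≢u
... | no  u≢v | yes v≡u = contradiction (sym v≡u) u≢v

T-all : ∀ {A : Set} (p : A → Bool) xs → T (all p xs) ⇔ All (T ∘ p) xs
T-all p []       = mk⇔ (λ _ → []) (λ _ → tt)
T-all p (x ∷ xs) = mk⇔
  (λ t → let px , pxs = to T-∧ t in px ∷ to (T-all p xs) pxs)
  (λ { (px ∷ pxs) → from T-∧ (px , from (T-all p xs) pxs) })

T-all-allFin : ∀ {n} (p : Fin n → Bool) → T (all p (allFin n)) ⇔ (∀ i → T (p i))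
T-all-allFin p = mk⇔ (tabulate⁻ ∘ to (T-all p _)) (from (T-all p _) ∘ tabulate⁺)

T-all-not : ∀ {n} (p : Fin n → Bool) → T (all (not ∘ p) (allFin n)) ⇔ (∀ i → ¬ T (p i))
T-all-not p = mk⇔ (λ t i → to T-not (to (T-all-allFin _) t i))
                  (λ f → from (T-all-allFin _) (λ i → from T-not (f i)))

𝟙-∧-disjoint : ∀ a b x → ¬ (T a × T b) → 𝟙 (a ∧ x) + 𝟙 (b ∧ x) ≤ 𝟙 x
𝟙-∧-disjoint true  true  x     ¬ab = contradiction (tt , tt) ¬ab
𝟙-∧-disjoint true  false true  _   = ≤-refl
𝟙-∧-disjoint true  false false _   = ≤-refl
𝟙-∧-disjoint false true  x     _   = ≤-refl
𝟙-∧-disjoint false false x     _   = z≤n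

𝟙-∧-∨-≤ : ∀ x a b p q → 𝟙 (x ∧ (a ∨ b ∨ p ∨ q)) ≤ 𝟙 a + 𝟙 b + (𝟙 p + 𝟙 (not p) * 𝟙 q)
𝟙-∧-∨-≤ false _     _     _     _     = z≤n
𝟙-∧-∨-≤ true  true  _     _     _     = s≤s z≤n
𝟙-∧-∨-≤ true  false true  _     _     = s≤s z≤n
𝟙-∧-∨-≤ true  false false true  _     = s≤s z≤n
𝟙-∧-∨-≤ true  false false false true  = s≤s z≤n
𝟙-∧-∨-≤ true  false false false false = z≤n

∑-mono-≤ : ∀ {n} {f g : Fin n → ℕ} → (∀ i → f i ≤ g i) → ∑[ i < n ] f i ≤ ∑[ i < n ] g i
∑-mono-≤ {zero}  _   = z≤n
∑-mono-≤ {suc n} f≤g = +-mono-≤ (f≤g zero) (∑-mono-≤ (f≤g ∘ suc))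

∑-const : ∀ n x → ∑[ i < n ] x ≡ n * x
∑-const zero    x = refl
∑-const (suc n) x = cong (x +_) (∑-const n x)

term≤∑ : ∀ {n} (f : Fin n → ℕ) i → f i ≤ ∑[ j < n ] f j
term≤∑ f zero    = m≤m+n _ _
term≤∑ f (suc i) = ≤-trans (term≤∑ (f ∘ suc) i) (m≤n+m _ _)

∑-𝟙-none : ∀ {n} (p : Fin n → Bool) → (∀ i → ¬ T (p i)) → ∑[ i < n ] 𝟙 (p i) ≡ 0
∑-𝟙-none {zero}  p none = refl
∑-𝟙-none {suc n} p none with p zero | none zero
... | false | _   = ∑-𝟙-none (p ∘ suc) (none ∘ suc)
... | true  | ¬p₀ = contradiction tt ¬p₀

∑-𝟙-≤1 : ∀ {n} (p : Fin n → Bool) → (∀ {i j} → T (p i) → T (p j) → i ≡ j) →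
         ∑[ i < n ] 𝟙 (p i) ≤ 1
∑-𝟙-≤1 {zero}  p unique = z≤n
∑-𝟙-≤1 {suc n} p unique with p zero in p₀
... | false = ∑-𝟙-≤1 (p ∘ suc) (suc-injective ∘₂ unique)
... | true  = s≤s (≤-reflexive (∑-𝟙-none (p ∘ suc) λ i pᵢ →
                contradiction (unique (from T-≡ p₀) pᵢ) λ ()))

∑-𝟙-complement : ∀ {n} (p : Fin n → Bool) → ∑[ i < n ] 𝟙 (p i) + ∑[ i < n ] 𝟙 (not (p i)) ≡ n
∑-𝟙-complement {n} p = begin
  ∑[ i < n ] 𝟙 (p i) + ∑[ i < n ] 𝟙 (not (p i))  ≡⟨ ∑-distrib-+ (𝟙 ∘ p) (𝟙 ∘ not ∘ p) ⟨
  ∑[ i < n ] (𝟙 (p i) + 𝟙 (not (p i)))           ≡⟨ sum-cong-≗ (𝟙+𝟙-not ∘ p) ⟩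
  ∑[ i < n ] 1                                   ≡⟨ ∑-const n 1 ⟩
  n * 1                                          ≡⟨ *-identityʳ n ⟩
  n                                              ∎
  where
  open ≡-Reasoning
  𝟙+𝟙-not : ∀ b → 𝟙 b + 𝟙 (not b) ≡ 1
  𝟙+𝟙-not true  = refl
  𝟙+𝟙-not false = refl

∑-𝟙-injection : ∀ {n} (P Q : Fin n → Bool) (R : Fin n → Fin n → Bool) →
                (∀ {i} → T (P i) → ∃[ j ] T (R i j)) →
                (∀ {i j} → T (R i j) → T (Q j)) →
                (∀ {i i′ j} → T (P i) → T (P i′) → T (R i j) → T (R i′ j) → i ≡ i′) →
                ∑[ i < n ] 𝟙 (P i) ≤ ∑[ j < n ] 𝟙 (Q j)
∑-𝟙-injection {n} P Q R image R⇒Q R-injective = begin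
  ∑[ i < n ] 𝟙 (P i)                     ≤⟨ ∑-mono-≤ P≤images ⟩
  ∑[ i < n ] ∑[ j < n ] 𝟙 (P i ∧ R i j)  ≡⟨ ∑-comm (λ i j → 𝟙 (P i ∧ R i j)) ⟩
  ∑[ j < n ] ∑[ i < n ] 𝟙 (P i ∧ R i j)  ≤⟨ ∑-mono-≤ preimages≤Q ⟩
  ∑[ j < n ] 𝟙 (Q j)                     ∎
  where
  open ≤-Reasoning
  P≤images : ∀ i → 𝟙 (P i) ≤ ∑[ j < n ] 𝟙 (P i ∧ R i j)
  P≤images i with P i in Pᵢ
  ... | false = z≤n
  ... | true  = let j , Rᵢⱼ = image (from T-≡ Pᵢ) in
                ≤-trans (≤-reflexive (sym (𝟙-true Rᵢⱼ))) (term≤∑ (λ j → 𝟙 (R i j)) j)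
  preimages≤Q : ∀ j → ∑[ i < n ] 𝟙 (P i ∧ R i j) ≤ 𝟙 (Q j)
  preimages≤Q j with Q j in Qⱼ
  ... | true  = ∑-𝟙-≤1 (λ i → P i ∧ R i j) λ t t′ →
                  let Pᵢ , Rᵢⱼ = to T-∧ t; Pᵢ′ , Rᵢ′ⱼ = to T-∧ t′ in R-injective Pᵢ Pᵢ′ Rᵢⱼ Rᵢ′ⱼ
  ... | false = ≤-reflexive (∑-𝟙-none (λ i → P i ∧ R i j) λ i t →
                  subst T Qⱼ (R⇒Q (proj₂ (to T-∧ t))))

∑-upper-triangle : ∀ {n} (q : Fin n → Fin n → Bool) → (∀ u v → q u v ≡ q v u) →
                   2 * ∑[ u < n ] ∑[ v < n ] 𝟙 ((toℕ u <ᵇ toℕ v) ∧ q u v) ≤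
                   ∑[ u < n ] ∑[ v < n ] 𝟙 (q u v)
∑-upper-triangle {n} q q-sym = begin
  2 * S                                             ≡⟨ cong (S +_) (+-identityʳ S) ⟩
  S + S                                             ≡⟨ cong (S +_) (∑-comm A) ⟩
  S + ∑[ u < n ] ∑[ v < n ] A v u                   ≡⟨ ∑-distrib-+ (λ u → ∑[ v < n ] A u v) _ ⟨
  ∑[ u < n ] (∑[ v < n ] A u v + ∑[ v < n ] A v u)  ≡⟨ sum-cong-≗ (λ u → ∑-distrib-+ (A u) (λ v → A v u)) ⟨
  ∑[ u < n ] ∑[ v < n ] (A u v + A v u)             ≤⟨ ∑-mono-≤ (λ u → ∑-mono-≤ (A+A≤q u)) ⟩
  ∑[ u < n ] ∑[ v < n ] 𝟙 (q u v)                   ∎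
  where
  open ≤-Reasoning
  A : Fin n → Fin n → ℕ
  A u v = 𝟙 ((toℕ u <ᵇ toℕ v) ∧ q u v)
  S = ∑[ u < n ] ∑[ v < n ] A u v
  A+A≤q : ∀ u v → A u v + A v u ≤ 𝟙 (q u v)
  A+A≤q u v rewrite q-sym v u = 𝟙-∧-disjoint (toℕ u <ᵇ toℕ v) (toℕ v <ᵇ toℕ u) (q u v)
    (λ (u<v , v<u) → <-asym (<ᵇ⇒< (toℕ u) (toℕ v) u<v) (<ᵇ⇒< (toℕ v) (toℕ u) v<u))

∑-meeting-pairs : ∀ {n} (p : Fin n → Bool) →
                  ∑[ u < n ] ∑[ v < n ] (𝟙 (p u) + 𝟙 (not (p u)) * 𝟙 (p v)) ≡
                  (n + ∑[ u < n ] 𝟙 (not (p u))) * ∑[ v < n ] 𝟙 (p v)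
∑-meeting-pairs {n} p = begin
  ∑[ u < n ] ∑[ v < n ] (𝟙 (p u) + 𝟙 (not (p u)) * 𝟙 (p v))
    ≡⟨ sum-cong-≗ (λ u → ∑-distrib-+ (λ _ → 𝟙 (p u)) (λ v → 𝟙 (not (p u)) * 𝟙 (p v))) ⟩
  ∑[ u < n ] (∑[ v < n ] 𝟙 (p u) + ∑[ v < n ] (𝟙 (not (p u)) * 𝟙 (p v)))
    ≡⟨ sum-cong-≗ (λ u → cong₂ _+_ (∑-const n (𝟙 (p u)))
                                   (sym (*-distribˡ-sum (𝟙 (not (p u))) (𝟙 ∘ p)))) ⟩
  ∑[ u < n ] (n * 𝟙 (p u) + 𝟙 (not (p u)) * e)
    ≡⟨ ∑-distrib-+ (λ u → n * 𝟙 (p u)) (λ u → 𝟙 (not (p u)) * e) ⟩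
  ∑[ u < n ] (n * 𝟙 (p u)) + ∑[ u < n ] (𝟙 (not (p u)) * e)
    ≡⟨ cong₂ _+_ (*-distribˡ-sum n (𝟙 ∘ p)) (*-distribʳ-sum e (𝟙 ∘ not ∘ p)) ⟨
  n * e + m * e
    ≡⟨ *-distribʳ-+ e n m ⟨
  (n + m) * e ∎
  where
  open ≡-Reasoning
  e = ∑[ v < n ] 𝟙 (p v)
  m = ∑[ u < n ] 𝟙 (not (p u))

count-++ : ∀ {A : Set} (p : A → Bool) xs ys → count p (xs ++ ys) ≡ count p xs + count p ys
count-++ p []       ys = refl
count-++ p (x ∷ xs) ys with p x
... | true  = cong suc (count-++ p xs ys)
... | false = count-++ p xs ys

count-concat-tabulate : ∀ {A B : Set} {n} (p : A → Bool) (g : B → List A) (f : Fin n → B) →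
                        count p (concat (map g (tabulate f))) ≡ ∑[ i < n ] count p (g (f i))
count-concat-tabulate {n = zero}  p g f = refl
count-concat-tabulate {n = suc n} p g f =
  trans (count-++ p (g (f zero)) _)
        (cong (count p (g (f zero)) +_) (count-concat-tabulate p g (f ∘ suc)))

count-if-singleton : ∀ {A : Set} (p : A → Bool) b x →
                     count p (if b then x ∷ [] else []) ≡ 𝟙 (b ∧ p x)
count-if-singleton p false x = refl
count-if-singleton p true  x with p x
... | true  = refl
... | false = refl

count-pairs : ∀ {n} (p : Fin n × Fin n → Bool) →
              count p (pairs n) ≡ ∑[ u < n ] ∑[ v < n ] 𝟙 ((toℕ u <ᵇ toℕ v) ∧ p (u , v))
count-pairs {n} p =
  trans (count-concat-tabulate p row id) (sum-cong-≗ λ u →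
  trans (count-concat-tabulate p (entry u) id) (sum-cong-≗ λ v →
  count-if-singleton p (toℕ u <ᵇ toℕ v) (u , v)))
  where
  entry : Fin n → Fin n → List (Fin n × Fin n)
  entry u v = if toℕ u <ᵇ toℕ v then (u , v) ∷ [] else []
  row : Fin n → List (Fin n × Fin n)
  row u = concat (map (entry u) (allFin n))

module _ {a ℓ₁ ℓ₂} (O : TotalPreorder a ℓ₁ ℓ₂) where
  open TotalPreorder O using (Carrier; _≲_; total) renaming (refl to ≲-refl; trans to ≲-trans)

  argmax-or-none : ∀ {n} (D : Fin n → Bool) (g : Fin n → Carrier) →
                   (∃[ m ] (T (D m) × (∀ j → T (D j) → g j ≲ g m))) ⊎ (∀ j → ¬ T (D j))
  argmax-or-none {zero}  D g = inj₂ λ ()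
  argmax-or-none {suc n} D g with argmax-or-none (D ∘ suc) (g ∘ suc) | D zero in D₀
  ... | inj₂ none | false = inj₂ λ { zero t → subst T D₀ t ; (suc j) → none j }
  ... | inj₂ none | true  =
    inj₁ (zero , from T-≡ D₀ , λ { zero _ → ≲-refl ; (suc j) t → contradiction t (none j) })
  ... | inj₁ (m , Dₘ , max) | false =
    inj₁ (suc m , Dₘ , λ { zero t → ⊥-elim (subst T D₀ t) ; (suc j) → max j })
  ... | inj₁ (m , Dₘ , max) | true with total (g zero) (g (suc m))
  ...   | inj₁ g₀≲gₘ = inj₁ (suc m , Dₘ , λ { zero _ → g₀≲gₘ ; (suc j) → max j })
  ...   | inj₂ gₘ≲g₀ =
    inj₁ (zero , from T-≡ D₀ , λ { zero _ → ≲-refl ; (suc j) t → ≲-trans (max j t) gₘ≲g₀ })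

  argmax : ∀ {n} (D : Fin n → Bool) (g : Fin n → Carrier) {i} → T (D i) →
           ∃[ m ] (T (D m) × (∀ j → T (D j) → g j ≲ g m))
  argmax D g {i} Dᵢ with argmax-or-none D g
  ... | inj₁ max  = max
  ... | inj₂ none = contradiction Dᵢ (none i)

another-vertex : ∀ {n} → 2 ≤ n → (v : Fin n) → ∃[ w ] w ≢ v
another-vertex (s≤s (s≤s _)) v = punchIn v zero , punchInᵢ≢i v zero

module _ {n} (lab : Labelling n) where

  isMin⇔ : ∀ {v u} → T (isMin lab v u) ⇔ (u ≢ v × (∀ w → w ≢ v → w ≢ u → lab v u < lab v w))
  isMin⇔ {v} {u} = mk⇔
    (λ t → let u≢v , minimal = to (T-∧ {not (u == v)}) t
               above = to (T-all-allFin (λ w → (w == v) ∨ (w == u) ∨ (lab v u <ᵇ lab v w))) minimal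
           in toWitnessFalse u≢v ,
              λ w w≢v w≢u → <ᵇ⇒< (lab v u) (lab v w) (to T-==-∨ (to T-==-∨ (above w) w≢v) w≢u))
    (λ (u≢v , minimal) → from T-∧ (fromWitnessFalse u≢v , from (T-all-allFin _) λ w →
      from T-==-∨ λ w≢v → from T-==-∨ λ w≢u → <⇒<ᵇ (minimal w w≢v w≢u)))

  isMin-unique : ∀ {v u u′} → T (isMin lab v u) → T (isMin lab v u′) → u ≡ u′
  isMin-unique {v} {u} {u′} t t′ with u ≟ u′
  ... | yes u≡u′ = u≡u′
  ... | no  u≢u′ = let u≢v , minimal = to isMin⇔ t; u′≢v , minimal′ = to isMin⇔ t′ in
                   contradiction (minimal u′ u′≢v (u≢u′ ∘ sym)) (<-asym (minimal′ u u≢v u≢u′))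

  module _ (c : Fin n → Fin n → Bool) where

    isMaxOut⇔ : ∀ {v u} → T (isMaxOut lab c v u) ⇔
                (∀ w → T (Eminus lab c v w) → w ≢ u → lab v w < lab v u)
    isMaxOut⇔ {v} {u} = mk⇔
      (λ t w v→w w≢u → <ᵇ⇒< (lab v w) (lab v u)
         (to T-==-∨ (to T-not-∨ (to (T-all-allFin _) t w) v→w) w≢u))
      (λ maximal → from (T-all-allFin _) λ w →
         from T-not-∨ λ v→w → from T-==-∨ (<⇒<ᵇ ∘ maximal w v→w))

    Eminus-≢ : ∀ {u v} → T (Eminus lab c u v) → u ≢ v
    Eminus-≢ u→v = proj₁ (to isMin⇔ (proj₁ (to T-∧ u→v)))

    maxOut-unique : ∀ {v u u′} → T (Eminus lab c v u) → T (isMaxOut lab c v u) →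
                    T (Eminus lab c v u′) → T (isMaxOut lab c v u′) → u ≡ u′
    maxOut-unique {v} {u} {u′} v→u max v→u′ max′ with u ≟ u′
    ... | yes u≡u′ = u≡u′
    ... | no  u≢u′ = contradiction (to isMaxOut⇔ max u′ v→u′ (u≢u′ ∘ sym))
                                   (<-asym (to isMaxOut⇔ max′ u v→u u≢u′))

    sink-no-arc : ∀ {s w} → T (isSink lab c s) → ¬ T (Eminus lab c s w)
    sink-no-arc sink = to (T-all-not (Eminus lab c _)) sink _

    emitter-no-arc : ∀ {s w} → T (isEmitter lab c s) → ¬ T (EminusT lab c s w)
    emitter-no-arc emitter = to (T-all-not (EminusT lab c _)) emitter _

    EminusT-cases : ∀ {a b} → T (EminusT lab c a b) →
                    (T (Eminus lab c a b) × T (isMaxOut lab c a b)) ⊎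
                    (T (Eminus lab c b a) × T (isSink lab c a))
    EminusT-cases {a} {b} t with to (T-∨ {Eminus lab c a b ∧ isMaxOut lab c a b}) t
    ... | inj₁ kept     = inj₁ (to T-∧ kept)
    ... | inj₂ reversed =
      let b→a , not-max-and-sink = to (T-∧ {Eminus lab c b a}) reversed
      in inj₂ (b→a , proj₂ (to (T-∧ {not (isMaxOut lab c b a)}) not-max-and-sink))

    EminusT-functional : ∀ {a b b′} → T (EminusT lab c a b) → T (EminusT lab c a b′) → b ≡ b′
    EminusT-functional {a} {b} {b′} t t′ with EminusT-cases {a} {b} t | EminusT-cases {a} {b′} t′
    ... | inj₁ (a→b , max) | inj₁ (a→b′ , max′) = maxOut-unique a→b max a→b′ max′
    ... | inj₁ (a→b , _)   | inj₂ (_ , sink)    = contradiction a→b (sink-no-arc sink)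
    ... | inj₂ (_ , sink)  | inj₁ (a→b′ , _)    = contradiction a→b′ (sink-no-arc sink)
    ... | inj₂ (b→a , _)   | inj₂ (b′→a , _)    =
      isMin-unique (proj₁ (to T-∧ b→a)) (proj₁ (to T-∧ b′→a))

LocallyInjective : ∀ {n} → Labelling n → Set
LocallyInjective {n} lab = ∀ (u v w : Fin n) → u ≢ v → u ≢ w → v ≢ w → lab u v ≢ lab u w

module _ {n} {lab : Labelling n} (injective : LocallyInjective lab) where

  isMin-exists : 2 ≤ n → ∀ v → ∃[ u ] T (isMin lab v u)
  isMin-exists 2≤n v =
    let w , w≢v = another-vertex 2≤n v
        u , u≢v , u-min = argmax (Flip.totalPreorder ≤-totalPreorder)
                                 (λ w → not (w == v)) (lab v) {w} (fromWitnessFalse w≢v)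
    in u , from (isMin⇔ lab) (toWitnessFalse u≢v , λ w w≢v w≢u →
         ≤∧≢⇒< (u-min w (fromWitnessFalse w≢v))
               (injective v u w (toWitnessFalse u≢v ∘ sym) (w≢v ∘ sym) (w≢u ∘ sym)))

  module _ (c : Fin n → Fin n → Bool) where

    emitter⇒sink : ∀ {s} → T (isEmitter lab c s) → T (isSink lab c s)
    emitter⇒sink {s} emitter = from (T-all-not (Eminus lab c s)) λ w s→w →
      let m , s→m , m-max = argmax ≤-totalPreorder (Eminus lab c s) (lab s) s→w
          maxOut : T (isMaxOut lab c s m)
          maxOut = from (isMaxOut⇔ lab c) λ v s→v v≢m →
            ≤∧≢⇒< (m-max v s→v) (injective s v m (Eminus-≢ lab c s→v) (Eminus-≢ lab c s→m) v≢m)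
      in emitter-no-arc lab c emitter (from T-∨ (inj₁ (from T-∧ (s→m , maxOut))))

    -- With e⁻(s) = {u, s}: were the tie broken towards (s, u), s would not be a sink; were
    -- (u, s) not the largest out-arc of u, it would be reversed into an arc of E⁻_T leaving s.
    emitter-parent : ValidChoice c → 2 ≤ n → ∀ {s} → T (isEmitter lab c s) →
                     ∃[ u ] T (Eminus lab c u s ∧ isMaxOut lab c u s)
    emitter-parent valid 2≤n {s} emitter = u , from T-∧ (u→s , maxOut)
      where
      sink = emitter⇒sink emitter
      u = proj₁ (isMin-exists 2≤n s)
      u-min : T (isMin lab s u)
      u-min = proj₂ (isMin-exists 2≤n s)
      chosen : T (isMin lab u s) → T (c u s)
      chosen s-min with T? (c u s)
      ... | yes cᵤₛ = cᵤₛ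
      ... | no ¬cᵤₛ =
        let cₛᵤ = subst T (sym (valid u s (proj₁ (to (isMin⇔ lab) u-min)))) (from T-not ¬cᵤₛ)
        in contradiction (from T-∧ (s-min , from T-∨ (inj₂ cₛᵤ))) (sink-no-arc lab c sink)
      u→s : T (Eminus lab c u s)
      u→s = from T-∧ (u-min , from T-not-∨ chosen)
      maxOut : T (isMaxOut lab c u s)
      maxOut with T? (isMaxOut lab c u s)
      ... | yes max = max
      ... | no ¬max = contradiction
        (from T-∨ (inj₂ (from T-∧ (u→s , from T-∧ (from T-not ¬max , sink)))))
        (emitter-no-arc lab c {w = u} emitter)

    emitters≤non-emitters : ValidChoice c → 2 ≤ n →
                            ∑[ s < n ] 𝟙 (isEmitter lab c s) ≤ ∑[ u < n ] 𝟙 (not (isEmitter lab c u))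
    emitters≤non-emitters valid 2≤n =
      ∑-𝟙-injection (isEmitter lab c) (not ∘ isEmitter lab c)
                    (λ s u → Eminus lab c u s ∧ isMaxOut lab c u s)
        (emitter-parent valid 2≤n)
        (λ {s} kept → from T-not λ emitter →
           emitter-no-arc lab c {w = s} emitter (from T-∨ (inj₁ kept)))
        (λ {s} {s′} {u} _ _ kept kept′ →
           let u→s , max = to (T-∧ {Eminus lab c u s}) kept
               u→s′ , max′ = to (T-∧ {Eminus lab c u s′}) kept′
           in maxOut-unique lab c u→s max u→s′ max′)

∑-EminusT≤n : ∀ {n} (lab : Labelling n) c → ∑[ u < n ] ∑[ v < n ] 𝟙 (EminusT lab c u v) ≤ n
∑-EminusT≤n {n} lab c = begin
  ∑[ u < n ] ∑[ v < n ] 𝟙 (EminusT lab c u v)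
    ≤⟨ ∑-mono-≤ (λ u → ∑-𝟙-≤1 (EminusT lab c u) (EminusT-functional lab c)) ⟩
  ∑[ u < n ] 1   ≡⟨ ∑-const n 1 ⟩
  n * 1          ≡⟨ *-identityʳ n ⟩
  n              ∎
  where open ≤-Reasoning

inCover-sym : ∀ {n} (lab : Labelling n) c u v → inCover lab c u v ≡ inCover lab c v u
inCover-sym lab c u v = cong₂ _∧_ (cong not (==-sym u v)) (begin
  a ∨ b ∨ x ∨ y    ≡⟨ ∨-assoc a b (x ∨ y) ⟨
  (a ∨ b) ∨ x ∨ y  ≡⟨ cong₂ _∨_ (∨-comm a b) (∨-comm x y) ⟩
  (b ∨ a) ∨ y ∨ x  ≡⟨ ∨-assoc b a (y ∨ x) ⟩
  b ∨ a ∨ y ∨ x    ∎)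
  where
  open ≡-Reasoning
  a = EminusT lab c u v
  b = EminusT lab c v u
  x = isEmitter lab c u
  y = isEmitter lab c v

coverSize-bound : ∀ {n} (lab : Labelling n) c →
                  2 * coverSize lab c ≤
                  2 * n + (n + ∑[ u < n ] 𝟙 (not (isEmitter lab c u))) * ∑[ v < n ] 𝟙 (isEmitter lab c v)
coverSize-bound {n} lab c = begin
  2 * coverSize lab c
    ≡⟨ cong (2 *_) (count-pairs (λ (u , v) → inCover lab c u v)) ⟩
  2 * ∑[ u < n ] ∑[ v < n ] 𝟙 ((toℕ u <ᵇ toℕ v) ∧ inCover lab c u v)
    ≤⟨ ∑-upper-triangle (inCover lab c) (inCover-sym lab c) ⟩
  ∑[ u < n ] ∑[ v < n ] 𝟙 (inCover lab c u v)
    ≤⟨ ∑-mono-≤ (λ u → ∑-mono-≤ λ v →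
         𝟙-∧-∨-≤ (not (u == v)) (arc u v) (arc v u) (emitter u) (emitter v)) ⟩
  ∑[ u < n ] ∑[ v < n ] (out u v + in′ u v + meets u v)
    ≡⟨ sum-cong-≗ (λ u → trans (∑-distrib-+ (λ v → out u v + in′ u v) (meets u))
                                (cong (_+ ∑[ v < n ] meets u v) (∑-distrib-+ (out u) (in′ u)))) ⟩
  ∑[ u < n ] (∑[ v < n ] out u v + ∑[ v < n ] in′ u v + ∑[ v < n ] meets u v)
    ≡⟨ trans (∑-distrib-+ (λ u → ∑[ v < n ] out u v + ∑[ v < n ] in′ u v) (λ u → ∑[ v < n ] meets u v))
             (cong (_+ M) (∑-distrib-+ (λ u → ∑[ v < n ] out u v) (λ u → ∑[ v < n ] in′ u v))) ⟩
  ∑[ u < n ] ∑[ v < n ] out u v + ∑[ u < n ] ∑[ v < n ] in′ u v + M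
    ≡⟨ cong (λ x → ∑[ u < n ] ∑[ v < n ] out u v + x + M) (∑-comm in′) ⟩
  ∑[ u < n ] ∑[ v < n ] out u v + ∑[ v < n ] ∑[ u < n ] out v u + M
    ≤⟨ +-mono-≤ (+-mono-≤ (∑-EminusT≤n lab c) (∑-EminusT≤n lab c))
                (≤-reflexive (∑-meeting-pairs emitter)) ⟩
  n + n + (n + m) * e
    ≡⟨ cong (λ x → n + x + (n + m) * e) (+-identityʳ n) ⟨
  2 * n + (n + m) * e ∎
  where
  open ≤-Reasoning
  arc = EminusT lab c
  emitter = isEmitter lab c
  out in′ meets : Fin n → Fin n → ℕ
  out u v = 𝟙 (arc u v)
  in′ u v = 𝟙 (arc v u)
  meets u v = 𝟙 (emitter u) + 𝟙 (not (emitter u)) * 𝟙 (emitter v)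
  M = ∑[ u < n ] ∑[ v < n ] meets u v
  e = ∑[ v < n ] 𝟙 (emitter v)
  m = ∑[ u < n ] 𝟙 (not (emitter u))

n*n≡2*nC2+n : ∀ n → n * n ≡ 2 * (n C 2) + n
n*n≡2*nC2+n zero    = refl
n*n≡2*nC2+n (suc n) = begin
  suc n * suc n                  ≡⟨ expand n ⟩
  n * n + (2 * n + 1)            ≡⟨ cong (_+ (2 * n + 1)) (n*n≡2*nC2+n n) ⟩
  2 * (n C 2) + n + (2 * n + 1)  ≡⟨ regroup n (n C 2) ⟩
  2 * (n + n C 2) + suc n        ≡⟨ cong (λ x → 2 * (x + n C 2) + suc n) (nC1≡n n) ⟨
  2 * (n C 1 + n C 2) + suc n    ≡⟨ cong (λ x → 2 * x + suc n) (nCk+nC[k+1]≡[n+1]C[k+1] n 1) ⟩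
  2 * (suc n C 2) + suc n        ∎
  where
  open ≡-Reasoning
  expand : ∀ n → suc n * suc n ≡ n * n + (2 * n + 1)
  expand = solve-∀
  regroup : ∀ n x → 2 * x + n + (2 * n + 1) ≡ 2 * (n + x) + suc n
  regroup = solve-∀

-- 3(e + m)² − 4(e + 2m)e = 3m² − e² − 2em, which is nonnegative as soon as e ≤ m.
e≤m⇒4[e+m+m]e≤3[e+m]² : ∀ {e m} → e ≤ m → 4 * ((e + m + m) * e) ≤ 3 * ((e + m) * (e + m))
e≤m⇒4[e+m+m]e≤3[e+m]² {e} {m} e≤m = +-cancelʳ-≤ (3 * (m * m)) _ _ (begin
  4 * ((e + m + m) * e) + 3 * (m * m)              ≡⟨ identity e m ⟩
  3 * ((e + m) * (e + m)) + (e * e + 2 * (e * m))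
    ≤⟨ +-monoʳ-≤ (3 * ((e + m) * (e + m)))
                 (+-mono-≤ (*-mono-≤ e≤m e≤m) (*-monoʳ-≤ 2 (*-monoˡ-≤ m e≤m))) ⟩
  3 * ((e + m) * (e + m)) + (m * m + 2 * (m * m))  ≡⟨ identity′ (e + m) m ⟩
  3 * ((e + m) * (e + m)) + 3 * (m * m)            ∎)
  where
  open ≤-Reasoning
  identity : ∀ e m → 4 * ((e + m + m) * e) + 3 * (m * m) ≡
                     3 * ((e + m) * (e + m)) + (e * e + 2 * (e * m))
  identity = solve-∀
  identity′ : ∀ n m → 3 * (n * n) + (m * m + 2 * (m * m)) ≡ 3 * (n * n) + 3 * (m * m)
  identity′ = solve-∀

cover-arithmetic : ∀ {s e m n} → e + m ≡ n → e ≤ m → 2 * s ≤ 2 * n + (n + m) * e →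
                   4 * s ≤ 3 * (n C 2) + 4 * 2 * n
cover-arithmetic {s} {e} {m} {n} refl e≤m bound = *-cancelˡ-≤ 2 (begin
  2 * (4 * s)                                  ≡⟨ swap s ⟩
  4 * (2 * s)                                  ≤⟨ *-monoʳ-≤ 4 bound ⟩
  4 * (2 * n + (n + m) * e)                    ≡⟨ *-distribˡ-+ 4 (2 * n) _ ⟩
  4 * (2 * n) + 4 * ((n + m) * e)              ≤⟨ +-monoʳ-≤ (4 * (2 * n)) (e≤m⇒4[e+m+m]e≤3[e+m]² e≤m) ⟩
  4 * (2 * n) + 3 * (n * n)                    ≡⟨ cong (λ x → 4 * (2 * n) + 3 * x) (n*n≡2*nC2+n n) ⟩
  4 * (2 * n) + 3 * (2 * (n C 2) + n)          ≤⟨ m≤m+n _ (5 * n) ⟩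
  4 * (2 * n) + 3 * (2 * (n C 2) + n) + 5 * n  ≡⟨ collect n (n C 2) ⟩
  2 * (3 * (n C 2) + 4 * 2 * n)                ∎)
  where
  open ≤-Reasoning
  swap : ∀ s → 2 * (4 * s) ≡ 4 * (2 * s)
  swap = solve-∀
  collect : ∀ n x → 4 * (2 * n) + 3 * (2 * x + n) + 5 * n ≡ 2 * (3 * x + 4 * 2 * n)
  collect = solve-∀

theorem3 : ∃[ K ] ((n : ℕ) → 2 ≤ n → (lab : Labelling n) → IsSimpleTemporalClique lab →
             (c : Fin n → Fin n → Bool) → ValidChoice c →
             4 * coverSize lab c ≤ 3 * (n C 2) + 4 * K * n)
theorem3 = 2 , λ n 2≤n lab (_ , injective) c valid →
  cover-arithmetic {coverSize lab c}
    (∑-𝟙-complement (isEmitter lab c))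
    (emitters≤non-emitters injective c valid 2≤n)
    (coverSize-bound lab c)
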